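{- Let $a,k$ be positive integers with $ak$ odd. Then for every positive integer $m$, $$t(a,3a,k,k;m)=\frac23\,N(a,3a,2k,2k;\,8m+4a+2k).$$
   Context: For positive integers $a,b,c,d$ and an integer $n\ge 0$, $N(a,b,c,d;n)$ denotes the number of $(x,y,z,w)\in\mathbb Z^4$ with $n=ax^2+by^2+cz^2+dw^2$, and $t(a,b,c,d;n)$ denotes the number of $(x,y,z,w)\in\mathbb Z^4$ with $n=a\frac{x(x-1)}2+b\frac{y(y-1)}2+c\frac{z(z-1)}2+d\frac{w(w-1)}2$. -}

module Defs where

open import Data.Nat as ℕ using (ℕ; suc)
open import Data.Integer as ℤ using (ℤ; +_; _+_; _*_; _-_)
import Data.Integer.Properties as ℤP
open import Data.List using (List; map; upTo; concatMap; length; filter)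
open import Data.Product using (_×_; _,_)
open import Relation.Binary.PropositionalEquality using (_≡_)

window : ℕ → List ℤ
window B = map (λ i → + i - + B) (upTo (suc (2 ℕ.* B)))

quads : ℕ → List (ℤ × ℤ × ℤ × ℤ)
quads B = concatMap (λ x → concatMap (λ y → concatMap (λ z →
            map (λ w → (x , y , z , w)) (window B)) (window B)) (window B)) (window B)

countQ : ℕ → (ℤ → ℤ → ℤ → ℤ → ℤ) → ℤ → ℕ
countQ B f v = length (filter (λ { (x , y , z , w) → f x y z w ℤP.≟ v }) (quads B))

-- N(a,b,c,d;n) = #{(x,y,z,w) ∈ ℤ⁴ : n = ax²+by²+cz²+dw²}.
-- Every solution (a,b,c,d ≥ 1) has |x|,|y|,|z|,|w| ≤ n, so counting over [-n,n]⁴ is exact.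
N : ℕ → ℕ → ℕ → ℕ → ℕ → ℕ
N a b c d n = countQ n (λ x y z w → + a * (x * x) + + b * (y * y) + + c * (z * z) + + d * (w * w)) (+ n)

-- t(a,b,c,d;n) = #{(x,y,z,w) ∈ ℤ⁴ : n = a x(x-1)/2 + b y(y-1)/2 + c z(z-1)/2 + d w(w-1)/2}.
-- Equation multiplied by 2 (x(x-1) is always even, so this is equivalent).
-- Each term x(x-1)/2 ≥ 0, and x(x-1)/2 ≤ n forces -n ≤ x ≤ n+1, so the window [-(n+1), n+1]⁴ is exact.
t : ℕ → ℕ → ℕ → ℕ → ℕ → ℕ
t a b c d n = countQ (suc n)
  (λ x y z w → + a * (x * (x - + 1)) + + b * (y * (y - + 1)) + + c * (z * (z - + 1)) + + d * (w * (w - + 1)))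
  (+ (2 ℕ.* n))

{-# OPTIONS --safe #-}
module Submission where

-- Let Q(X, Y, U, V) = aX² + 3aY² + kU² + kV² and n = 8m + 4a + 2k.  As a(2x − 1)² = 4a·x(x − 1) + a,
-- t(a, 3a, k, k; m) counts the solutions of Q = n with all coordinates odd; as
-- 2kZ² + 2kW² = k(Z + W)² + k(Z − W)², N(a, 3a, 2k, 2k; n) counts the solutions with U ≡ V (mod 2).
-- Modulo 4 the latter are either all odd or have X, Y even and U, V odd, so N = t + E where E counts
-- the solutions (2p, 2q, U, V) with U, V odd.  Modulo 8 these have p + q odd, and since
-- (p + 3q)² + 3(p − q)² = (2p)² + 3(2q)², the maps (p, q) ↦ (p + 3q, ±(p − q)) send them bijectively
-- onto the all-odd solutions with X ≡ ±Y (mod 4).  Hence t = 2E, and 3t = 2N.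

open import Defs
open import Level using (Level; 0ℓ)
open import Data.Nat as ℕ using (ℕ; _≤_; z≤n; s≤s; NonZero)
import Data.Nat.Properties as ℕP
open import Data.Nat.Tactic.RingSolver as ℕSolver using ()
open import Data.Integer using (ℤ; +_)
open import Data.Product using (_×_; _,_; proj₁; proj₂; ∃-syntax)
open import Data.Sum using (_⊎_; inj₁; inj₂; [_,_]′)
import Data.Sum as Sum
open import Data.Empty using (⊥-elim)
open import Data.List using ([]; _∷_; _++_; map; concatMap; filter; length; cartesianProduct)
open import Data.List.Properties using (length-++; length-map; map-++; map-∘)
open import Data.List.Membership.Propositional using (_∈_)
open import Data.List.Membership.Propositional.Properties
  using (∈-map⁺; ∈-map⁻; ∈-++⁺ˡ; ∈-++⁺ʳ; ∈-++⁻; ∈-filter⁺; ∈-filter⁻)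
open import Data.List.Membership.Propositional.Properties.WithK using (unique∧set⇒bag)
open import Data.List.Relation.Binary.BagAndSetEquality using (∼bag⇒↭)
open import Data.List.Relation.Binary.Permutation.Propositional.Properties using (↭-length)
open import Data.List.Relation.Unary.Unique.Propositional using (Unique)
import Data.List.Relation.Unary.Unique.Propositional.Properties as Unique
open import Function.Bundles using (_⇔_; mk⇔; Equivalence)
open import Function.Definitions using (Injective)
open import Relation.Nullary using (¬_)
open import Relation.Unary using (Pred; Decidable; _⊆_; _≐_; _∩_; _∪_; _⊥_; _⊢_)
open import Relation.Binary.PropositionalEquality
  using (_≡_; refl; sym; trans; cong; cong₂; subst; module ≡-Reasoning)

private
  variable
    a ℓ ℓ′ ℓ″ : Level
    A B C : Set a

infix 4 _HasSize_

_HasSize_ : Pred A ℓ → ℕ → Set _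
P HasSize n = ∃[ xs ] Unique xs × (∀ {x} → x ∈ xs ⇔ P x) × length xs ≡ n

Range : (A → B) → Pred B _
Range f y = ∃[ x ] f x ≡ y

size-unique : ∀ {P : Pred A ℓ} {Q : Pred A ℓ′} {i j} → P ≐ Q → P HasSize i → Q HasSize j → i ≡ j
size-unique (P⊆Q , Q⊆P) (xs , xs! , xs⇔P , refl) (ys , ys! , ys⇔Q , refl) =
  ↭-length (∼bag⇒↭ (unique∧set⇒bag xs! ys! (mk⇔
    (λ x∈xs → Equivalence.from ys⇔Q (P⊆Q (Equivalence.to xs⇔P x∈xs)))
    (λ x∈ys → Equivalence.from xs⇔P (Q⊆P (Equivalence.to ys⇔Q x∈ys))))))

size-resp : ∀ {P : Pred A ℓ} {Q : Pred A ℓ′} {i} → P ≐ Q → P HasSize i → Q HasSize i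
size-resp (P⊆Q , Q⊆P) (xs , xs! , xs⇔P , |xs|) =
  xs , xs! ,
  mk⇔ (λ x∈xs → P⊆Q (Equivalence.to xs⇔P x∈xs)) (λ Qx → Equivalence.from xs⇔P (Q⊆P Qx)) ,
  |xs|

size-filter : ∀ {P : Pred A ℓ} (P? : Decidable P) {xs} → Unique xs → P ⊆ (_∈ xs) →
              P HasSize length (filter P? xs)
size-filter P? {xs} xs! P⊆xs =
  filter P? xs ,
  Unique.filter⁺ P? xs! ,
  mk⇔ (λ x∈ → proj₂ (∈-filter⁻ P? {xs = xs} x∈)) (λ Px → ∈-filter⁺ P? (P⊆xs Px) Px) ,
  refl

size-∪ : ∀ {P : Pred A ℓ} {Q : Pred A ℓ′} {i j} → P ⊥ Q → P HasSize i → Q HasSize j →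
         (P ∪ Q) HasSize (i ℕ.+ j)
size-∪ P⊥Q (xs , xs! , xs⇔P , refl) (ys , ys! , ys⇔Q , refl) =
  xs ++ ys ,
  Unique.++⁺ xs! ys! (λ (x∈xs , x∈ys) → P⊥Q (Equivalence.to xs⇔P x∈xs , Equivalence.to ys⇔Q x∈ys)) ,
  mk⇔ (λ x∈ → Sum.map (Equivalence.to xs⇔P) (Equivalence.to ys⇔Q) (∈-++⁻ xs x∈))
      [ (λ Px → ∈-++⁺ˡ (Equivalence.from xs⇔P Px)) , (λ Qx → ∈-++⁺ʳ xs (Equivalence.from ys⇔Q Qx)) ]′ ,
  length-++ xs

size-partition : ∀ {P : Pred A ℓ} {Q : Pred A ℓ′} {R : Pred A ℓ″} {i j k} →
                 P ≐ Q ∪ R → Q ⊥ R → P HasSize i → Q HasSize j → R HasSize k → i ≡ j ℕ.+ k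
size-partition P≐Q∪R Q⊥R |P| |Q| |R| = size-unique P≐Q∪R |P| (size-∪ Q⊥R |Q| |R|)

size-image : ∀ {f : A → B} {P : Pred B ℓ} {i} → Injective _≡_ _≡_ f →
             (f ⊢ P) HasSize i → (P ∩ Range f) HasSize i
size-image {f = f} {P} f-inj (xs , xs! , xs⇔ , refl) =
  map f xs , Unique.map⁺ f-inj xs! , mk⇔ to from , length-map f xs
  where
  to : ∀ {y} → y ∈ map f xs → (P ∩ Range f) y
  to y∈ with x , x∈xs , refl ← ∈-map⁻ f y∈ = Equivalence.to xs⇔ x∈xs , x , refl
  from : ∀ {y} → (P ∩ Range f) y → y ∈ map f xs
  from (Py , x , refl) = ∈-map⁺ f (Equivalence.from xs⇔ Py)

restrict-partition : ∀ {S : Pred A ℓ} {P Q R : Pred A ℓ′} →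
  (∀ {y} → S y → P y → Q y ⊎ R y) → (∀ {y} → S y → Q y → P y) → (∀ {y} → S y → R y → P y) →
  S ∩ P ≐ (S ∩ Q) ∪ (S ∩ R)
restrict-partition split Q⊆P R⊆P =
  (λ (s , p) → Sum.map (s ,_) (s ,_) (split s p)) ,
  [ (λ (s , q) → s , Q⊆P s q) , (λ (s , r) → s , R⊆P s r) ]′

map-cartesianProduct : ∀ (f : A × B → C) xs ys →
  map f (cartesianProduct xs ys) ≡ concatMap (λ x → map (λ y → f (x , y)) ys) xs
map-cartesianProduct f []       ys = refl
map-cartesianProduct f (x ∷ xs) ys = begin
  map f (map (x ,_) ys ++ cartesianProduct xs ys)
    ≡⟨ map-++ f (map (x ,_) ys) _ ⟩
  map f (map (x ,_) ys) ++ map f (cartesianProduct xs ys)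
    ≡⟨ cong₂ _++_ (sym (map-∘ ys)) (map-cartesianProduct f xs ys) ⟩
  map (λ y → f (x , y)) ys ++ concatMap (λ x → map (λ y → f (x , y)) ys) xs ∎
  where open ≡-Reasoning

summands≤sum : ∀ s₁ s₂ s₃ s₄ → let s = s₁ ℕ.+ s₂ ℕ.+ s₃ ℕ.+ s₄ in
               s₁ ≤ s × s₂ ≤ s × s₃ ≤ s × s₄ ≤ s
summands≤sum s₁ s₂ s₃ s₄ =
  ℕP.≤-trans (ℕP.m≤m+n s₁ s₂) s₁+s₂≤s ,
  ℕP.≤-trans (ℕP.m≤n+m s₂ s₁) s₁+s₂≤s ,
  ℕP.≤-trans (ℕP.m≤n+m s₃ (s₁ ℕ.+ s₂)) (ℕP.m≤m+n _ s₄) ,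
  ℕP.m≤n+m s₄ _
  where
  s₁+s₂≤s : s₁ ℕ.+ s₂ ≤ s₁ ℕ.+ s₂ ℕ.+ s₃ ℕ.+ s₄
  s₁+s₂≤s = ℕP.≤-trans (ℕP.m≤m+n _ s₃) (ℕP.m≤m+n _ s₄)

n≤n*n : ∀ n → n ≤ n ℕ.* n
n≤n*n ℕ.zero    = z≤n
n≤n*n (ℕ.suc n) = ℕP.m≤m*n (ℕ.suc n) (ℕ.suc n)

3t≡2N : ∀ {t N E} → N ≡ t ℕ.+ E → t ≡ E ℕ.+ E → 3 ℕ.* t ≡ 2 ℕ.* N
3t≡2N {E = E} refl refl = identity E
  where
  identity : ∀ e → 3 ℕ.* (e ℕ.+ e) ≡ 2 ℕ.* (e ℕ.+ e ℕ.+ e)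
  identity = ℕSolver.solve-∀

module Parity where

  open import Data.Integer using (ℤ; +_; ∣_∣; _+_; _*_; _-_; _/_; _%_)
  import Data.Integer.Properties as ℤP
  open import Data.Integer.Tactic.RingSolver using (solve-∀)
  open import Data.Integer.DivMod using (a≡a%n+[a/n]*n; n%d<d)
  import Data.Nat.DivMod as ℕDivMod

  toOdd : ℤ → ℤ
  toOdd x = + 2 * x - + 1

  Even Odd : Pred ℤ 0ℓ
  Even = Range (+ 2 *_)
  Odd  = Range toOdd

  even-or-odd : ∀ x → Even x ⊎ Odd x
  even-or-odd x with x % + 2 | n%d<d x (+ 2) | a≡a%n+[a/n]*n x (+ 2)
  ... | 0                 | _            | x≡ = inj₁ (x / + 2 , sym (trans x≡ (even (x / + 2))))
    where
    even : ∀ h → + 0 + h * + 2 ≡ + 2 * h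
    even = solve-∀
  ... | 1                 | _            | x≡ = inj₂ (x / + 2 + + 1 , sym (trans x≡ (odd (x / + 2))))
    where
    odd : ∀ h → + 1 + h * + 2 ≡ + 2 * (h + + 1) - + 1
    odd = solve-∀
  ... | ℕ.suc (ℕ.suc _)   | s≤s (s≤s ()) | _

  even⇒¬odd : ∀ {x} → Even x → ¬ Odd x
  even⇒¬odd (i , refl) (j , toOdd-j≡2i) = ℕP.even≢odd ∣ j - i ∣ 0 (begin
    2 ℕ.* ∣ j - i ∣              ≡⟨ sym (ℤP.abs-* (+ 2) (j - i)) ⟩
    ∣ + 2 * (j - i) ∣            ≡⟨ cong ∣_∣ (difference i j) ⟩
    ∣ toOdd j - + 2 * i + + 1 ∣  ≡⟨ cong (λ s → ∣ s - + 2 * i + + 1 ∣) toOdd-j≡2i ⟩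
    ∣ + 2 * i - + 2 * i + + 1 ∣  ≡⟨ cong ∣_∣ (cancel i) ⟩
    1                            ∎)
    where
    open ≡-Reasoning
    difference : ∀ i j → + 2 * (j - i) ≡ (+ 2 * j - + 1) - + 2 * i + + 1
    difference = solve-∀
    cancel : ∀ i → + 2 * i - + 2 * i + + 1 ≡ + 1
    cancel = solve-∀

  2e≡2f+x⇒even : ∀ {x} e f → + 2 * e ≡ + 2 * f + x → Even x
  2e≡2f+x⇒even {x} e f 2e≡2f+x = e - f , (begin
    + 2 * (e - f)          ≡⟨ distrib e f ⟩
    + 2 * e - + 2 * f      ≡⟨ cong (_- + 2 * f) 2e≡2f+x ⟩
    + 2 * f + x - + 2 * f  ≡⟨ cancel f x ⟩
    x                      ∎)
    where
    open ≡-Reasoning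
    distrib : ∀ e f → + 2 * (e - f) ≡ + 2 * e - + 2 * f
    distrib = solve-∀
    cancel : ∀ f x → + 2 * f + x - + 2 * f ≡ x
    cancel = solve-∀

  shift-even : ∀ {x y} → Even x → (c : ℤ) → x + + 2 * c ≡ y → Even y
  shift-even (i , refl) c refl = i + c , ℤP.*-distribˡ-+ (+ 2) i c

  shift-odd : ∀ {x y} → Odd x → (c : ℤ) → x + + 2 * c ≡ y → Odd y
  shift-odd (j , refl) c refl = j + c , identity j c
    where
    identity : ∀ j c → + 2 * (j + c) - + 1 ≡ (+ 2 * j - + 1) + + 2 * c
    identity = solve-∀

  pronic-even : ∀ x → Even (x * (x - + 1))
  pronic-even x with even-or-odd x
  ... | inj₁ (j , refl) = j * (+ 2 * j - + 1) , identity j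
    where
    identity : ∀ j → + 2 * (j * (+ 2 * j - + 1)) ≡ + 2 * j * (+ 2 * j - + 1)
    identity = solve-∀
  ... | inj₂ (j , refl) = (+ 2 * j - + 1) * (j - + 1) , identity j
    where
    identity : ∀ j → + 2 * ((+ 2 * j - + 1) * (j - + 1)) ≡ (+ 2 * j - + 1) * ((+ 2 * j - + 1) - + 1)
    identity = solve-∀

  odd-product⇒odd : ∀ a k → (a ℕ.* k) ℕ.% 2 ≡ 1 → Odd (+ a)
  odd-product⇒odd a k ak-odd
    with a ℕ.% 2 | ℕDivMod.m%n<n a 2 | ℕDivMod.%-distribˡ-* a k 2 | ℕDivMod.m≡m%n+[m/n]*n a 2
  ... | 0               | _            | ak%2≡0 | _  = ⊥-elim (ℕP.0≢1+n (trans (sym ak%2≡0) ak-odd))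
  ... | 1               | _            | _      | a≡ = + (a ℕ./ 2) + + 1 , (begin
    toOdd (+ (a ℕ./ 2) + + 1)   ≡⟨ identity (+ (a ℕ./ 2)) ⟩
    + 1 + + (a ℕ./ 2) * + 2     ≡⟨ cong (λ h → + 1 + h) (sym (ℤP.pos-* (a ℕ./ 2) 2)) ⟩
    + (1 ℕ.+ a ℕ./ 2 ℕ.* 2)     ≡⟨ cong +_ (sym a≡) ⟩
    + a                         ∎)
    where
    open ≡-Reasoning
    identity : ∀ h → + 2 * (h + + 1) - + 1 ≡ + 1 + h * + 2
    identity = solve-∀
  ... | ℕ.suc (ℕ.suc _) | s≤s (s≤s ()) | _      | _

module Enumeration where

  open import Data.Integer using (ℤ; +_; -[1+_]; ∣_∣; _+_; _*_; _-_; -_)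
  import Data.Integer.Properties as ℤP
  open import Data.Integer.Tactic.RingSolver using (solve-∀)
  open import Data.List.Properties using (map-id; concatMap-cong)
  open import Data.List.Membership.Propositional.Properties using (∈-upTo⁺; ∈-cartesianProduct⁺)
  open import Algebra.Properties.AbelianGroup ℤP.+-0-abelianGroup using (∙-cancelʳ)

  ℤ⁴ : Set
  ℤ⁴ = ℤ × ℤ × ℤ × ℤ

  InBox : ℕ → Pred ℤ⁴ 0ℓ
  InBox B (x , y , z , w) = ∣ x ∣ ≤ B × ∣ y ∣ ≤ B × ∣ z ∣ ≤ B × ∣ w ∣ ≤ B

  Fibre : (ℤ → ℤ → ℤ → ℤ → ℤ) → ℤ → Pred ℤ⁴ 0ℓ
  Fibre f v (x , y , z , w) = f x y z w ≡ v

  fibre? : ∀ f v → Decidable (Fibre f v)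
  fibre? f v (x , y , z , w) = f x y z w ℤP.≟ v

  window-unique : ∀ B → Unique (window B)
  window-unique B = Unique.map⁺ (λ eq → ℤP.+-injective (∙-cancelʳ (- + B) _ _ eq)) (Unique.upTo⁺ _)

  shift-to-ℕ : ∀ {B} x → ∣ x ∣ ≤ B → ∃[ i ] + i ≡ x + + B
  shift-to-ℕ {B} (+ n)    _   = n ℕ.+ B , ℤP.pos-+ n B
  shift-to-ℕ {B} -[1+ n ] n<B = B ℕ.∸ ℕ.suc n , sym (trans (ℤP.+-comm -[1+ n ] (+ B)) (ℤP.⊖-≥ n<B))

  ∈-window : ∀ {B} x → ∣ x ∣ ≤ B → x ∈ window B
  ∈-window {B} x ∣x∣≤B with i , i≡x+B ← shift-to-ℕ x ∣x∣≤B =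
    subst (_∈ window B) i-B≡x (∈-map⁺ (λ j → + j - + B) (∈-upTo⁺ (s≤s i≤2B)))
    where
    cancel : ∀ x b → x + b - b ≡ x
    cancel = solve-∀
    i-B≡x : + i - + B ≡ x
    i-B≡x = trans (cong (_- + B) i≡x+B) (cancel x (+ B))
    i≤2B : i ≤ 2 ℕ.* B
    i≤2B = begin
      i              ≡⟨ cong ∣_∣ i≡x+B ⟩
      ∣ x + + B ∣    ≤⟨ ℤP.∣i+j∣≤∣i∣+∣j∣ x (+ B) ⟩
      ∣ x ∣ ℕ.+ B    ≤⟨ ℕP.+-monoˡ-≤ B ∣x∣≤B ⟩
      B ℕ.+ B        ≡⟨ cong (B ℕ.+_) (sym (ℕP.+-identityʳ B)) ⟩
      2 ℕ.* B        ∎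
      where open ℕP.≤-Reasoning

  cube≡quads : ∀ B → let W = window B in
    cartesianProduct W (cartesianProduct W (cartesianProduct W W)) ≡ quads B
  cube≡quads B = begin
    cartesianProduct W (cartesianProduct W (cartesianProduct W W))
      ≡⟨ sym (map-id _) ⟩
    map (λ p → p) (cartesianProduct W (cartesianProduct W (cartesianProduct W W)))
      ≡⟨ map-cartesianProduct _ W _ ⟩
    concatMap (λ x → map (x ,_) (cartesianProduct W (cartesianProduct W W))) W
      ≡⟨ concatMap-cong (λ x → trans (map-cartesianProduct _ W _)
           (concatMap-cong (λ y → map-cartesianProduct _ W W) W)) W ⟩
    quads B ∎
    where
    W = window B
    open ≡-Reasoning

  quads-unique : ∀ B → Unique (quads B)
  quads-unique B = subst Unique (cube≡quads B)
    (Unique.cartesianProduct⁺ W! (Unique.cartesianProduct⁺ W! (Unique.cartesianProduct⁺ W! W!)))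
    where W! = window-unique B

  ∈-quads : ∀ {B} p → InBox B p → p ∈ quads B
  ∈-quads {B} p@(x , y , z , w) (x≤ , y≤ , z≤ , w≤) = subst (p ∈_) (cube≡quads B)
    (∈-cartesianProduct⁺ (∈-window x x≤) (∈-cartesianProduct⁺ (∈-window y y≤)
      (∈-cartesianProduct⁺ (∈-window z z≤) (∈-window w w≤))))

  countQ-size : ∀ {B f v} → Fibre f v ⊆ InBox B → Fibre f v HasSize countQ B f v
  countQ-size {B} {f} {v} bounded =
    size-filter (fibre? f v) (quads-unique B) (λ {p} sol → ∈-quads p (bounded sol))

  module _ (g : ℤ → ℤ) (weight : ℤ → ℕ) (g≡weight : ∀ e → g e ≡ + weight e) where

    weights-bounded :
      ∀ c₁ c₂ c₃ c₄ .{{_ : NonZero c₁}} .{{_ : NonZero c₂}} .{{_ : NonZero c₃}} .{{_ : NonZero c₄}}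
      {e₁ e₂ e₃ e₄ v} → + c₁ * g e₁ + + c₂ * g e₂ + + c₃ * g e₃ + + c₄ * g e₄ ≡ + v →
      weight e₁ ≤ v × weight e₂ ≤ v × weight e₃ ≤ v × weight e₄ ≤ v
    weights-bounded c₁ c₂ c₃ c₄ {e₁} {e₂} {e₃} {e₄} {v} eq =
      let b₁ , b₂ , b₃ , b₄ = summands≤sum s₁ s₂ s₃ s₄ in
      bound c₁ e₁ b₁ , bound c₂ e₂ b₂ , bound c₃ e₃ b₃ , bound c₄ e₄ b₄
      where
      s₁ = c₁ ℕ.* weight e₁
      s₂ = c₂ ℕ.* weight e₂
      s₃ = c₃ ℕ.* weight e₃
      s₄ = c₄ ℕ.* weight e₄
      term : ∀ c e → + c * g e ≡ + (c ℕ.* weight e)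
      term c e = trans (cong (+ c *_) (g≡weight e)) (sym (ℤP.pos-* c (weight e)))
      total : s₁ ℕ.+ s₂ ℕ.+ s₃ ℕ.+ s₄ ≡ v
      total = ℤP.+-injective (begin
        + (s₁ ℕ.+ s₂ ℕ.+ s₃ ℕ.+ s₄)   ≡⟨ ℤP.pos-+ (s₁ ℕ.+ s₂ ℕ.+ s₃) s₄ ⟩
        + (s₁ ℕ.+ s₂ ℕ.+ s₃) + + s₄   ≡⟨ cong (_+ + s₄) (ℤP.pos-+ (s₁ ℕ.+ s₂) s₃) ⟩
        + (s₁ ℕ.+ s₂) + + s₃ + + s₄   ≡⟨ cong (λ s → s + + s₃ + + s₄) (ℤP.pos-+ s₁ s₂) ⟩
        + s₁ + + s₂ + + s₃ + + s₄
          ≡⟨ sym (cong₂ _+_ (cong₂ _+_ (cong₂ _+_ (term c₁ e₁) (term c₂ e₂)) (term c₃ e₃)) (term c₄ e₄)) ⟩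
        + c₁ * g e₁ + + c₂ * g e₂ + + c₃ * g e₃ + + c₄ * g e₄ ≡⟨ eq ⟩
        + v                           ∎)
        where open ≡-Reasoning
      bound : ∀ c .{{_ : NonZero c}} e → c ℕ.* weight e ≤ s₁ ℕ.+ s₂ ℕ.+ s₃ ℕ.+ s₄ → weight e ≤ v
      bound c e cw≤s = ℕP.≤-trans (ℕP.m≤n*m (weight e) c) (subst (c ℕ.* weight e ≤_) total cw≤s)

  diagonalForm pronicForm : ℕ → ℕ → ℕ → ℕ → ℤ → ℤ → ℤ → ℤ → ℤ
  diagonalForm a b c d x y z w = + a * (x * x) + + b * (y * y) + + c * (z * z) + + d * (w * w)
  pronicForm a b c d x y z w =
    + a * (x * (x - + 1)) + + b * (y * (y - + 1)) + + c * (z * (z - + 1)) + + d * (w * (w - + 1))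

  square≡∣∣² : ∀ e → e * e ≡ + (∣ e ∣ ℕ.* ∣ e ∣)
  square≡∣∣² (+ n)    = sym (ℤP.pos-* n n)
  square≡∣∣² -[1+ n ] = refl

  pronic : ℤ → ℕ
  pronic (+ n)    = n ℕ.* (n ℕ.∸ 1)
  pronic -[1+ n ] = ℕ.suc n ℕ.* ℕ.suc (ℕ.suc n)

  pronic≡ : ∀ x → x * (x - + 1) ≡ + pronic x
  pronic≡ (+ ℕ.zero)  = refl
  pronic≡ (+ ℕ.suc n) =
    trans (cong (+ ℕ.suc n *_) (ℤP.[+m]-[+n]≡m⊖n (ℕ.suc n) 1)) (sym (ℤP.pos-* (ℕ.suc n) n))
  pronic≡ -[1+ n ]    = cong (λ s → -[1+ n ] * -[1+ ℕ.suc s ]) (ℕP.+-identityʳ n)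

  2∣x∣≤pronic[x]+2 : ∀ x → 2 ℕ.* ∣ x ∣ ≤ pronic x ℕ.+ 2
  2∣x∣≤pronic[x]+2 (+ ℕ.zero)          = z≤n
  2∣x∣≤pronic[x]+2 (+ ℕ.suc ℕ.zero)    = s≤s (s≤s z≤n)
  2∣x∣≤pronic[x]+2 (+ ℕ.suc (ℕ.suc n)) = subst (2 ℕ.* ℕ.suc (ℕ.suc n) ≤_) (sym (identity n)) (ℕP.m≤m+n _ _)
    where
    identity : ∀ n → ℕ.suc (ℕ.suc n) ℕ.* ℕ.suc n ℕ.+ 2 ≡ 2 ℕ.* ℕ.suc (ℕ.suc n) ℕ.+ n ℕ.* ℕ.suc n
    identity = ℕSolver.solve-∀
  2∣x∣≤pronic[x]+2 -[1+ n ]            = subst (2 ℕ.* ℕ.suc n ≤_) (sym (identity n)) (ℕP.m≤m+n _ _)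
    where
    identity : ∀ n → ℕ.suc n ℕ.* ℕ.suc (ℕ.suc n) ℕ.+ 2 ≡ 2 ℕ.* ℕ.suc n ℕ.+ (n ℕ.* ℕ.suc n ℕ.+ 2)
    identity = ℕSolver.solve-∀

  diagonalForm-bound :
    ∀ {a b c d v} .{{_ : NonZero a}} .{{_ : NonZero b}} .{{_ : NonZero c}} .{{_ : NonZero d}} →
    Fibre (diagonalForm a b c d) (+ v) ⊆ InBox v
  diagonalForm-bound {a} {b} {c} {d} {x = x , y , z , w} eq
    with bx , by , bz , bw ← weights-bounded (λ e → e * e) _ square≡∣∣² a b c d {x} {y} {z} {w} eq =
    root x bx , root y by , root z bz , root w bw
    where
    root : ∀ e {v} → ∣ e ∣ ℕ.* ∣ e ∣ ≤ v → ∣ e ∣ ≤ v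
    root e = ℕP.≤-trans (n≤n*n ∣ e ∣)

  pronicForm-bound :
    ∀ {a b c d v} .{{_ : NonZero a}} .{{_ : NonZero b}} .{{_ : NonZero c}} .{{_ : NonZero d}} →
    Fibre (pronicForm a b c d) (+ (2 ℕ.* v)) ⊆ InBox (ℕ.suc v)
  pronicForm-bound {a} {b} {c} {d} {v} {x = x , y , z , w} eq
    with bx , by , bz , bw ← weights-bounded (λ e → e * (e - + 1)) pronic pronic≡ a b c d {x} {y} {z} {w} eq =
    root x bx , root y by , root z bz , root w bw
    where
    root : ∀ e → pronic e ≤ 2 ℕ.* v → ∣ e ∣ ≤ ℕ.suc v
    root e p≤2v = ℕP.*-cancelˡ-≤ 2 (begin
      2 ℕ.* ∣ e ∣        ≤⟨ 2∣x∣≤pronic[x]+2 e ⟩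
      pronic e ℕ.+ 2     ≤⟨ ℕP.+-monoˡ-≤ 2 p≤2v ⟩
      2 ℕ.* v ℕ.+ 2      ≡⟨ ℕP.+-comm (2 ℕ.* v) 2 ⟩
      2 ℕ.+ 2 ℕ.* v      ≡⟨ sym (ℕP.*-suc 2 v) ⟩
      2 ℕ.* ℕ.suc v      ∎)
      where open ℕP.≤-Reasoning

module Substitutions where

  open import Data.Integer as ℤ using (ℤ; +_; -[1+_]; ∣_∣; _+_; _*_; _-_; -_)
  import Data.Integer.Properties as ℤP
  open import Data.Integer.Tactic.RingSolver using (solve-∀)
  open import Algebra.Properties.AbelianGroup ℤP.+-0-abelianGroup using (∙-cancelʳ)
  open Parity
  open Enumeration using (ℤ⁴)

  odds evens sumDiff ψ₊ ψ₋ : ℤ⁴ → ℤ⁴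
  odds    (x , y , z , w) = toOdd x , toOdd y , toOdd z , toOdd w
  evens   (p , q , u , v) = + 2 * p , + 2 * q , toOdd u , toOdd v
  sumDiff (x , y , z , w) = x , y , z + w , z - w
  ψ₊      (p , q , u , v) = p + + 3 * q , p - q , toOdd u , toOdd v
  ψ₋      (p , q , u , v) = p + + 3 * q , q - p , toOdd u , toOdd v

  quad-≡ : ∀ {x₁ x₂ x₃ x₄ y₁ y₂ y₃ y₄ : A} → x₁ ≡ y₁ → x₂ ≡ y₂ → x₃ ≡ y₃ → x₄ ≡ y₄ →
           (x₁ , x₂ , x₃ , x₄) ≡ (y₁ , y₂ , y₃ , y₄)
  quad-≡ refl refl refl refl = refl

  quad-≡⁻¹ : ∀ {x₁ x₂ x₃ x₄ y₁ y₂ y₃ y₄ : A} → (x₁ , x₂ , x₃ , x₄) ≡ (y₁ , y₂ , y₃ , y₄) →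
             x₁ ≡ y₁ × x₂ ≡ y₂ × x₃ ≡ y₃ × x₄ ≡ y₄
  quad-≡⁻¹ refl = refl , refl , refl , refl

  cancel-via : ∀ c .{{_ : ℤ.NonZero c}} (r : ℤ → ℤ → ℤ) {x x′ s s′ t t′} →
               c * x ≡ r s t → c * x′ ≡ r s′ t′ → s ≡ s′ → t ≡ t′ → x ≡ x′
  cancel-via c r cx≡ cx′≡ refl refl = ℤP.*-cancelˡ-≡ c _ _ (trans cx≡ (sym cx′≡))

  double-injective : Injective _≡_ _≡_ (+ 2 *_)
  double-injective = ℤP.*-cancelˡ-≡ (+ 2) _ _

  toOdd-injective : Injective _≡_ _≡_ toOdd
  toOdd-injective eq = double-injective (∙-cancelʳ (- + 1) _ _ eq)

  odds-injective : Injective _≡_ _≡_ odds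
  odds-injective {_ , _ , _ , _} {_ , _ , _ , _} eq =
    let e₁ , e₂ , e₃ , e₄ = quad-≡⁻¹ eq in
    quad-≡ (toOdd-injective e₁) (toOdd-injective e₂) (toOdd-injective e₃) (toOdd-injective e₄)

  evens-injective : Injective _≡_ _≡_ evens
  evens-injective {_ , _ , _ , _} {_ , _ , _ , _} eq =
    let e₁ , e₂ , e₃ , e₄ = quad-≡⁻¹ eq in
    quad-≡ (double-injective e₁) (double-injective e₂) (toOdd-injective e₃) (toOdd-injective e₄)

  sumDiff-injective : Injective _≡_ _≡_ sumDiff
  sumDiff-injective {_ , _ , z , w} {_ , _ , z′ , w′} eq =
    let e₁ , e₂ , e₃ , e₄ = quad-≡⁻¹ eq in
    quad-≡ e₁ e₂ (cancel-via (+ 2) _+_ (sum z w) (sum z′ w′) e₃ e₄)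
                 (cancel-via (+ 2) _-_ (difference z w) (difference z′ w′) e₃ e₄)
    where
    sum : ∀ z w → + 2 * z ≡ (z + w) + (z - w)
    sum = solve-∀
    difference : ∀ z w → + 2 * w ≡ (z + w) - (z - w)
    difference = solve-∀

  ψ₊-injective : Injective _≡_ _≡_ ψ₊
  ψ₊-injective {p , q , _ , _} {p′ , q′ , _ , _} eq =
    let e₁ , e₂ , e₃ , e₄ = quad-≡⁻¹ eq
        q≡q′ = cancel-via (+ 4) _-_ (recover-q p q) (recover-q p′ q′) e₁ e₂
    in quad-≡ (cancel-via (+ 1) _+_ (recover-p p q) (recover-p p′ q′) e₂ q≡q′) q≡q′
              (toOdd-injective e₃) (toOdd-injective e₄)
    where
    recover-q : ∀ p q → + 4 * q ≡ (p + + 3 * q) - (p - q)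
    recover-q = solve-∀
    recover-p : ∀ p q → + 1 * p ≡ (p - q) + q
    recover-p = solve-∀

  ψ₋-injective : Injective _≡_ _≡_ ψ₋
  ψ₋-injective {p , q , _ , _} {p′ , q′ , _ , _} eq =
    let e₁ , e₂ , e₃ , e₄ = quad-≡⁻¹ eq
        q≡q′ = cancel-via (+ 4) _+_ (recover-q p q) (recover-q p′ q′) e₁ e₂
    in quad-≡ (cancel-via (+ 1) (λ s t → t - s) (recover-p p q) (recover-p p′ q′) e₂ q≡q′) q≡q′
              (toOdd-injective e₃) (toOdd-injective e₄)
    where
    recover-q : ∀ p q → + 4 * q ≡ (p + + 3 * q) + (q - p)
    recover-q = solve-∀
    recover-p : ∀ p q → + 1 * p ≡ q - (q - p)
    recover-p = solve-∀

  ∣x∣≤∣2x∣ : ∀ x → ∣ x ∣ ≤ ∣ + 2 * x ∣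
  ∣x∣≤∣2x∣ x = subst (∣ x ∣ ≤_) (sym (ℤP.abs-* (+ 2) x)) (ℕP.m≤m+n ∣ x ∣ _)

  ∣x∣≤∣toOdd[x]∣ : ∀ x → ∣ x ∣ ≤ ∣ toOdd x ∣
  ∣x∣≤∣toOdd[x]∣ (+ ℕ.zero)  = z≤n
  ∣x∣≤∣toOdd[x]∣ (+ ℕ.suc n) =
    subst (ℕ.suc n ≤_) (cong (n ℕ.+_) (sym (ℕP.*-identityˡ (ℕ.suc n)))) (ℕP.m≤n+m (ℕ.suc n) n)
  ∣x∣≤∣toOdd[x]∣ -[1+ n ]    =
    s≤s (ℕP.m≤n⇒m≤1+n (ℕP.≤-trans (ℕP.m≤m+n n (1 ℕ.* ℕ.suc n)) (ℕP.m≤m+n _ 0)))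

  y+[x-y]≡x : ∀ x y → y + (x - y) ≡ x
  y+[x-y]≡x = solve-∀

  odds-range : ∀ {x y z w} → Odd x → Odd y → Odd z → Odd w → Range odds (x , y , z , w)
  odds-range (i , refl) (j , refl) (k , refl) (l , refl) = (i , j , k , l) , refl

  evens-range : ∀ {x y z w} → Even x → Even y → Odd z → Odd w → Range evens (x , y , z , w)
  evens-range (i , refl) (j , refl) (k , refl) (l , refl) = (i , j , k , l) , refl

  odds-evens-disjoint : ∀ {y} → Range odds y → ¬ Range evens y
  odds-evens-disjoint ((x , _ , _ , _) , refl) ((p , _ , _ , _) , eq) =
    even⇒¬odd (p , proj₁ (quad-≡⁻¹ eq)) (x , refl)

  odds⊆sumDiff : Range odds ⊆ Range sumDiff
  odds⊆sumDiff ((x , y , z , w) , refl) =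
    (toOdd x , toOdd y , z + w - + 1 , z - w) , quad-≡ refl refl (sum z w) (difference z w)
    where
    sum : ∀ z w → (z + w - + 1) + (z - w) ≡ + 2 * z - + 1
    sum = solve-∀
    difference : ∀ z w → (z + w - + 1) - (z - w) ≡ + 2 * w - + 1
    difference = solve-∀

  evens⊆sumDiff : Range evens ⊆ Range sumDiff
  evens⊆sumDiff ((p , q , u , v) , refl) =
    (+ 2 * p , + 2 * q , u + v - + 1 , u - v) , quad-≡ refl refl (sum u v) (difference u v)
    where
    sum : ∀ z w → (z + w - + 1) + (z - w) ≡ + 2 * z - + 1
    sum = solve-∀
    difference : ∀ z w → (z + w - + 1) - (z - w) ≡ + 2 * w - + 1
    difference = solve-∀

  odds-split : Range odds ⊆ Range ψ₊ ∪ Range ψ₋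
  odds-split ((x₁ , x₂ , x₃ , x₄) , refl) with even-or-odd (x₁ - x₂)
  ... | inj₁ (j , 2j≡x₁-x₂) =
    inj₁ ((toOdd x₂ + j , j , x₃ , x₄) ,
          quad-≡ (trans (first x₂ j) (cong toOdd x₁≡)) (second x₂ j) refl refl)
    where
    x₁≡ : x₂ + + 2 * j ≡ x₁
    x₁≡ = trans (cong (λ d → x₂ + d) 2j≡x₁-x₂) (y+[x-y]≡x x₁ x₂)
    first : ∀ x j → (+ 2 * x - + 1 + j) + + 3 * j ≡ + 2 * (x + + 2 * j) - + 1
    first = solve-∀
    second : ∀ x j → (+ 2 * x - + 1 + j) - j ≡ + 2 * x - + 1
    second = solve-∀
  ... | inj₂ (j , toOdd-j≡x₁-x₂) =
    inj₂ ((j - x₂ , x₂ + j - + 1 , x₃ , x₄) ,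
          quad-≡ (trans (first x₂ j) (cong toOdd x₁≡)) (second x₂ j) refl refl)
    where
    x₁≡ : x₂ + toOdd j ≡ x₁
    x₁≡ = trans (cong (λ d → x₂ + d) toOdd-j≡x₁-x₂) (y+[x-y]≡x x₁ x₂)
    first : ∀ x j → (j - x) + + 3 * (x + j - + 1) ≡ + 2 * (x + (+ 2 * j - + 1)) - + 1
    first = solve-∀
    second : ∀ x j → (x + j - + 1) - (j - x) ≡ + 2 * x - + 1
    second = solve-∀

module Solutions (A K M : ℤ) (A-odd : Parity.Odd A) (K-odd : Parity.Odd K) where

  open import Data.Integer using (ℤ; +_; _+_; _*_; _-_; -_)
  import Data.Integer.Properties as ℤP
  open import Data.Integer.Tactic.RingSolver using (solve-∀)
  open import Algebra.Properties.AbelianGroup ℤP.+-0-abelianGroup using (∙-cancelʳ)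
  open Parity
  open Enumeration using (ℤ⁴)
  open Substitutions

  Q : ℤ⁴ → ℤ
  Q (x , y , z , w) = A * (x * x) + + 3 * A * (y * y) + K * (z * z) + K * (w * w)

  n : ℤ
  n = + 8 * M + + 4 * A + + 2 * K

  Sol : Pred ℤ⁴ 0ℓ
  Sol y = Q y ≡ n

  4x+c≡4y+c⇒x≡y : ∀ {x y} c → + 4 * x + c ≡ + 4 * y + c → x ≡ y
  4x+c≡4y+c⇒x≡y c eq = ℤP.*-cancelˡ-≡ (+ 4) _ _ (∙-cancelʳ c _ _ eq)

  pronicQ : ℤ⁴ → ℤ
  pronicQ (x , y , z , w) =
    A * (x * (x - + 1)) + + 3 * A * (y * (y - + 1)) + K * (z * (z - + 1)) + K * (w * (w - + 1))

  Q∘odds≡ : ∀ x → Q (odds x) ≡ + 4 * pronicQ x + (+ 4 * A + + 2 * K)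
  Q∘odds≡ (x , y , z , w) = identity A K x y z w
    where
    identity : ∀ a k x y z w →
      a * ((+ 2 * x - + 1) * (+ 2 * x - + 1)) + + 3 * a * ((+ 2 * y - + 1) * (+ 2 * y - + 1)) +
      k * ((+ 2 * z - + 1) * (+ 2 * z - + 1)) + k * ((+ 2 * w - + 1) * (+ 2 * w - + 1)) ≡
      + 4 * (a * (x * (x - + 1)) + + 3 * a * (y * (y - + 1)) + k * (z * (z - + 1)) + k * (w * (w - + 1))) +
      (+ 4 * a + + 2 * k)
    identity = solve-∀

  n≡ : n ≡ + 4 * (+ 2 * M) + (+ 4 * A + + 2 * K)
  n≡ = identity A K M
    where
    identity : ∀ a k m → + 8 * m + + 4 * a + + 2 * k ≡ + 4 * (+ 2 * m) + (+ 4 * a + + 2 * k)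
    identity = solve-∀

  odds-fibre : odds ⊢ Sol ≐ (λ x → pronicQ x ≡ + 2 * M)
  odds-fibre =
    (λ {x} sol → 4x+c≡4y+c⇒x≡y _ (trans (sym (Q∘odds≡ x)) (trans sol n≡))) ,
    (λ {x} eq → trans (Q∘odds≡ x) (trans (cong (λ s → + 4 * s + (+ 4 * A + + 2 * K)) eq) (sym n≡)))

  Q∘ψ₊≡Q∘evens : ∀ x → Q (ψ₊ x) ≡ Q (evens x)
  Q∘ψ₊≡Q∘evens (p , q , u , v) =
    cong (λ s → s + K * (toOdd u * toOdd u) + K * (toOdd v * toOdd v)) (isometry A p q)
    where
    isometry : ∀ a p q → a * ((p + + 3 * q) * (p + + 3 * q)) + + 3 * a * ((p - q) * (p - q)) ≡
                         a * ((+ 2 * p) * (+ 2 * p)) + + 3 * a * ((+ 2 * q) * (+ 2 * q))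
    isometry = solve-∀

  Q∘ψ₋≡Q∘evens : ∀ x → Q (ψ₋ x) ≡ Q (evens x)
  Q∘ψ₋≡Q∘evens (p , q , u , v) =
    cong (λ s → s + K * (toOdd u * toOdd u) + K * (toOdd v * toOdd v)) (isometry A p q)
    where
    isometry : ∀ a p q → a * ((p + + 3 * q) * (p + + 3 * q)) + + 3 * a * ((q - p) * (q - p)) ≡
                         a * ((+ 2 * p) * (+ 2 * p)) + + 3 * a * ((+ 2 * q) * (+ 2 * q))
    isometry = solve-∀

  -- If x − y is odd then Q (sumDiff …) − n is odd; if x − y and z + w are both even, it is 2 mod 4.
  sumDiff-solution-parity : ∀ x y z w → Sol (sumDiff (x , y , z , w)) → Even (x - y) × Odd (z + w)
  sumDiff-solution-parity x y z w sol with even-or-odd (x - y) | even-or-odd (z + w)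
  ... | inj₁ x-y-even | inj₂ z+w-odd = x-y-even , z+w-odd
  ... | inj₂ (d , toOdd-d≡x-y) | _ = ⊥-elim (even⇒¬odd (2e≡2f+x⇒even F E 2F≡2E+A) A-odd)
    where
    open ≡-Reasoning
    E F : ℤ
    E = A * (+ 2 * (y * y) + + 2 * (y * d) - y + + 2 * (d * d) - + 2 * d) + K * (z * z + w * w)
    F = + 4 * M + + 2 * A + K
    expand : ∀ a k y d z w →
      a * ((y + (+ 2 * d - + 1)) * (y + (+ 2 * d - + 1))) + + 3 * a * (y * y) +
      k * ((z + w) * (z + w)) + k * ((z - w) * (z - w)) ≡
      + 2 * (a * (+ 2 * (y * y) + + 2 * (y * d) - y + + 2 * (d * d) - + 2 * d) + k * (z * z + w * w)) + a
    expand = solve-∀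
    halve : ∀ a k m → + 8 * m + + 4 * a + + 2 * k ≡ + 2 * (+ 4 * m + + 2 * a + k)
    halve = solve-∀
    x≡ : x ≡ y + toOdd d
    x≡ = sym (trans (cong (λ e → y + e) toOdd-d≡x-y) (y+[x-y]≡x x y))
    2F≡2E+A : + 2 * F ≡ + 2 * E + A
    2F≡2E+A = begin
      + 2 * F                                 ≡⟨ sym (halve A K M) ⟩
      n                                       ≡⟨ sym sol ⟩
      Q (sumDiff (x , y , z , w))             ≡⟨ cong (λ x → Q (sumDiff (x , y , z , w))) x≡ ⟩
      Q (sumDiff (y + toOdd d , y , z , w))   ≡⟨ expand A K y d z w ⟩
      + 2 * E + A                             ∎
  ... | inj₁ (d , 2d≡x-y) | inj₁ (s , 2s≡z+w) =
    ⊥-elim (even⇒¬odd (2e≡2f+x⇒even E F (double-injective 4E≡4F+2K)) K-odd)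
    where
    open ≡-Reasoning
    E F : ℤ
    E = A * (y * y + y * d + d * d) + K * (s * s + (s - w) * (s - w))
    F = + 2 * M + A
    expand : ∀ a k y d s w →
      a * ((y + + 2 * d) * (y + + 2 * d)) + + 3 * a * (y * y) +
      k * ((+ 2 * s) * (+ 2 * s)) + k * ((+ 2 * s - + 2 * w) * (+ 2 * s - + 2 * w)) ≡
      + 2 * (+ 2 * (a * (y * y + y * d + d * d) + k * (s * s + (s - w) * (s - w))))
    expand = solve-∀
    halve : ∀ a k m → + 8 * m + + 4 * a + + 2 * k ≡ + 2 * (+ 2 * (+ 2 * m + a) + k)
    halve = solve-∀
    z-w≡ : ∀ z w → z - w ≡ (z + w) - + 2 * w
    z-w≡ = solve-∀
    coordinates : (y + + 2 * d , y , + 2 * s , + 2 * s - + 2 * w) ≡ (x , y , z + w , z - w)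
    coordinates = quad-≡ (trans (cong (λ e → y + e) 2d≡x-y) (y+[x-y]≡x x y)) refl 2s≡z+w
                         (trans (cong (_- + 2 * w) 2s≡z+w) (sym (z-w≡ z w)))
    4E≡4F+2K : + 2 * (+ 2 * E) ≡ + 2 * (+ 2 * F + K)
    4E≡4F+2K = begin
      + 2 * (+ 2 * E)                                     ≡⟨ sym (expand A K y d s w) ⟩
      Q (y + + 2 * d , y , + 2 * s , + 2 * s - + 2 * w)   ≡⟨ cong Q coordinates ⟩
      Q (sumDiff (x , y , z , w))                         ≡⟨ sol ⟩
      n                                                   ≡⟨ halve A K M ⟩
      + 2 * (+ 2 * F + K)                                 ∎

  -- Q (evens (p , q , u , v)) = n divided by 4 reads A(p² + 3q²) + K(u(u − 1) + v(v − 1)) = 2M + A,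
  -- whose left-hand side is even when p + q is.
  evens-solution-parity : ∀ p q u v → Sol (evens (p , q , u , v)) → Odd (p + q)
  evens-solution-parity p q u v sol with even-or-odd (p + q)
  ... | inj₂ p+q-odd = p+q-odd
  ... | inj₁ (j , 2j≡p+q) = ⊥-elim (even⇒¬odd (2e≡2f+x⇒even G M 2G≡2M+A) A-odd)
    where
    open ≡-Reasoning
    tu = proj₁ (pronic-even u)
    tv = proj₁ (pronic-even v)
    G : ℤ
    G = A * (j * (p - q) + + 2 * (q * q)) + K * (tu + tv)
    expand : ∀ a k p q u v →
      a * ((+ 2 * p) * (+ 2 * p)) + + 3 * a * ((+ 2 * q) * (+ 2 * q)) +
      k * ((+ 2 * u - + 1) * (+ 2 * u - + 1)) + k * ((+ 2 * v - + 1) * (+ 2 * v - + 1)) ≡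
      + 4 * (a * ((p + q) * (p - q) + + 4 * (q * q)) + k * (u * (u - + 1) + v * (v - + 1))) + + 2 * k
    expand = solve-∀
    quarter : ∀ a k m → + 8 * m + + 4 * a + + 2 * k ≡ + 4 * (+ 2 * m + a) + + 2 * k
    quarter = solve-∀
    halved : A * ((p + q) * (p - q) + + 4 * (q * q)) + K * (u * (u - + 1) + v * (v - + 1)) ≡ + 2 * M + A
    halved = 4x+c≡4y+c⇒x≡y (+ 2 * K) (trans (sym (expand A K p q u v)) (trans sol (quarter A K M)))
    double : ∀ a k j p q tu tv →
      + 2 * (a * (j * (p - q) + + 2 * (q * q)) + k * (tu + tv)) ≡
      a * (+ 2 * j * (p - q) + + 4 * (q * q)) + k * (+ 2 * tu + + 2 * tv)
    double = solve-∀
    2G≡2M+A : + 2 * G ≡ + 2 * M + A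
    2G≡2M+A = begin
      + 2 * G                                                               ≡⟨ double A K j p q tu tv ⟩
      A * (+ 2 * j * (p - q) + + 4 * (q * q)) + K * (+ 2 * tu + + 2 * tv)
        ≡⟨ cong₂ (λ s t → A * (s * (p - q) + + 4 * (q * q)) + K * t) 2j≡p+q
                 (cong₂ _+_ (proj₂ (pronic-even u)) (proj₂ (pronic-even v))) ⟩
      A * ((p + q) * (p - q) + + 4 * (q * q)) + K * (u * (u - + 1) + v * (v - + 1)) ≡⟨ halved ⟩
      + 2 * M + A                                                           ∎

  ψ₊-solution-odds : ∀ {y} → Sol y → Range ψ₊ y → Range odds y
  ψ₊-solution-odds sol ((p , q , u , v) , refl) =
    let p+q-odd = evens-solution-parity p q u v (trans (sym (Q∘ψ₊≡Q∘evens (p , q , u , v))) sol) in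
    odds-range (shift-odd p+q-odd q (first p q)) (shift-odd p+q-odd (- q) (second p q)) (u , refl) (v , refl)
    where
    first : ∀ p q → p + q + + 2 * q ≡ p + + 3 * q
    first = solve-∀
    second : ∀ p q → p + q + + 2 * (- q) ≡ p - q
    second = solve-∀

  ψ₋-solution-odds : ∀ {y} → Sol y → Range ψ₋ y → Range odds y
  ψ₋-solution-odds sol ((p , q , u , v) , refl) =
    let p+q-odd = evens-solution-parity p q u v (trans (sym (Q∘ψ₋≡Q∘evens (p , q , u , v))) sol) in
    odds-range (shift-odd p+q-odd q (first p q)) (shift-odd p+q-odd (- p) (second p q)) (u , refl) (v , refl)
    where
    first : ∀ p q → p + q + + 2 * q ≡ p + + 3 * q
    first = solve-∀
    second : ∀ p q → p + q + + 2 * (- p) ≡ q - p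
    second = solve-∀

  ψ₊-ψ₋-disjoint : ∀ {y} → Sol y → Range ψ₊ y → ¬ Range ψ₋ y
  ψ₊-ψ₋-disjoint sol ((p , q , u , v) , refl) ((p′ , q′ , _ , _) , eq) =
    let e₁ , e₂ , _ , _ = quad-≡⁻¹ eq in
    even⇒¬odd (q′ , double-injective (begin
      + 2 * (+ 2 * q′)               ≡⟨ sum₋ p′ q′ ⟩
      (p′ + + 3 * q′) + (q′ - p′)    ≡⟨ cong₂ _+_ e₁ e₂ ⟩
      (p + + 3 * q) + (p - q)        ≡⟨ sum₊ p q ⟩
      + 2 * (p + q)                  ∎))
      (evens-solution-parity p q u v (trans (sym (Q∘ψ₊≡Q∘evens (p , q , u , v))) sol))
    where
    open ≡-Reasoning
    sum₋ : ∀ p q → + 2 * (+ 2 * q) ≡ (p + + 3 * q) + (q - p)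
    sum₋ = solve-∀
    sum₊ : ∀ p q → (p + + 3 * q) + (p - q) ≡ + 2 * (p + q)
    sum₊ = solve-∀

  sumDiff-split : ∀ {y} → Sol y → Range sumDiff y → Range odds y ⊎ Range evens y
  sumDiff-split sol ((x , y , z , w) , refl) =
    let (d , 2d≡x-y) , z+w-odd = sumDiff-solution-parity x y z w sol
        y+2d≡x = trans (cong (λ e → y + e) 2d≡x-y) (y+[x-y]≡x x y)
        z-w-odd = shift-odd z+w-odd (- w) (subtract-twice z w)
    in [ (λ y-even → inj₂ (evens-range (shift-even y-even d y+2d≡x) y-even z+w-odd z-w-odd))
       , (λ y-odd → inj₁ (odds-range (shift-odd y-odd d y+2d≡x) y-odd z+w-odd z-w-odd))
       ]′ (even-or-odd y)
    where
    subtract-twice : ∀ z w → z + w + + 2 * (- w) ≡ z - w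
    subtract-twice = solve-∀

  sumDiff-partition : Sol ∩ Range sumDiff ≐ (Sol ∩ Range odds) ∪ (Sol ∩ Range evens)
  sumDiff-partition = restrict-partition sumDiff-split (λ _ → odds⊆sumDiff) (λ _ → evens⊆sumDiff)

  odds-partition : Sol ∩ Range odds ≐ (Sol ∩ Range ψ₊) ∪ (Sol ∩ Range ψ₋)
  odds-partition = restrict-partition (λ _ → odds-split) ψ₊-solution-odds ψ₋-solution-odds

  odds⊥evens : (Sol ∩ Range odds) ⊥ (Sol ∩ Range evens)
  odds⊥evens ((_ , o) , (_ , e)) = odds-evens-disjoint o e

  ψ₊⊥ψ₋ : (Sol ∩ Range ψ₊) ⊥ (Sol ∩ Range ψ₋)
  ψ₊⊥ψ₋ ((sol , r₊) , (_ , r₋)) = ψ₊-ψ₋-disjoint sol r₊ r₋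

module Counts (a k m : ℕ) .{{_ : NonZero a}} .{{_ : NonZero k}}
              (a-odd : Parity.Odd (+ a)) (k-odd : Parity.Odd (+ k)) where

  open import Data.Integer using (ℤ; +_; _+_; _*_; _-_)
  import Data.Integer.Properties as ℤP
  open import Data.Integer.Tactic.RingSolver using (solve-∀)
  open Parity using (toOdd)
  open Enumeration
  open Substitutions
  open Solutions (+ a) (+ k) (+ m) a-odd k-odd

  private instance
    3a≢0 : NonZero (3 ℕ.* a)
    3a≢0 = ℕP.m*n≢0 3 a
    2k≢0 : NonZero (2 ℕ.* k)
    2k≢0 = ℕP.m*n≢0 2 k

  nℕ : ℕ
  nℕ = 8 ℕ.* m ℕ.+ 4 ℕ.* a ℕ.+ 2 ℕ.* k

  nℕ≡n : + nℕ ≡ n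
  nℕ≡n = trans (ℤP.pos-+ (8 ℕ.* m ℕ.+ 4 ℕ.* a) (2 ℕ.* k))
    (cong₂ _+_ (trans (ℤP.pos-+ (8 ℕ.* m) (4 ℕ.* a)) (cong₂ _+_ (ℤP.pos-* 8 m) (ℤP.pos-* 4 a)))
               (ℤP.pos-* 2 k))

  Q≡diagonalForm : ∀ x y z w → Q (x , y , z , w) ≡ diagonalForm a (3 ℕ.* a) k k x y z w
  Q≡diagonalForm x y z w =
    cong (λ c → + a * (x * x) + c * (y * y) + + k * (z * z) + + k * (w * w)) (sym (ℤP.pos-* 3 a))

  Q∘sumDiff≡diagonalForm : ∀ x y z w →
    Q (sumDiff (x , y , z , w)) ≡ diagonalForm a (3 ℕ.* a) (2 ℕ.* k) (2 ℕ.* k) x y z w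
  Q∘sumDiff≡diagonalForm x y z w = trans (identity (+ a) (+ k) x y z w)
    (cong₂ (λ c d → + a * (x * x) + c * (y * y) + d * (z * z) + d * (w * w))
           (sym (ℤP.pos-* 3 a)) (sym (ℤP.pos-* 2 k)))
    where
    identity : ∀ a k x y z w →
      a * (x * x) + + 3 * a * (y * y) + k * ((z + w) * (z + w)) + k * ((z - w) * (z - w)) ≡
      a * (x * x) + + 3 * a * (y * y) + + 2 * k * (z * z) + + 2 * k * (w * w)
    identity = solve-∀

  pronicForm≡pronicQ : ∀ x y z w → pronicForm a (3 ℕ.* a) k k x y z w ≡ pronicQ (x , y , z , w)
  pronicForm≡pronicQ x y z w =
    cong (λ c → + a * (x * (x - + 1)) + c * (y * (y - + 1)) + + k * (z * (z - + 1)) + + k * (w * (w - + 1)))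
         (ℤP.pos-* 3 a)

  evensForm : ℤ → ℤ → ℤ → ℤ → ℤ
  evensForm p q u v = diagonalForm a (3 ℕ.* a) k k (+ 2 * p) (+ 2 * q) (toOdd u) (toOdd v)

  evensForm-bound : Fibre evensForm (+ nℕ) ⊆ InBox nℕ
  evensForm-bound {p , q , u , v} eq =
    let bp , bq , bu , bv = diagonalForm-bound {a} {3 ℕ.* a} {k} {k} {nℕ} {evens (p , q , u , v)} eq in
    ℕP.≤-trans (∣x∣≤∣2x∣ p) bp , ℕP.≤-trans (∣x∣≤∣2x∣ q) bq ,
    ℕP.≤-trans (∣x∣≤∣toOdd[x]∣ u) bu , ℕP.≤-trans (∣x∣≤∣toOdd[x]∣ v) bv

  E : ℕ
  E = countQ nℕ evensForm (+ nℕ)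

  t-size : (Sol ∩ Range odds) HasSize t a (3 ℕ.* a) k k m
  t-size = size-image odds-injective
    (size-resp fibre≐ (countQ-size (λ {x} → pronicForm-bound {a} {3 ℕ.* a} {k} {k} {m} {x})))
    where
    fibre≐ : Fibre (pronicForm a (3 ℕ.* a) k k) (+ (2 ℕ.* m)) ≐ odds ⊢ Sol
    fibre≐ =
      (λ {(x , y , z , w)} eq → proj₂ odds-fibre {x , y , z , w}
         (trans (sym (pronicForm≡pronicQ x y z w)) (trans eq (ℤP.pos-* 2 m)))) ,
      (λ {(x , y , z , w)} sol → trans (pronicForm≡pronicQ x y z w)
         (trans (proj₁ odds-fibre {x , y , z , w} sol) (sym (ℤP.pos-* 2 m))))

  N-size : (Sol ∩ Range sumDiff) HasSize N a (3 ℕ.* a) (2 ℕ.* k) (2 ℕ.* k) nℕ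
  N-size = size-image sumDiff-injective
    (size-resp fibre≐ (countQ-size (λ {x} → diagonalForm-bound {a} {3 ℕ.* a} {2 ℕ.* k} {2 ℕ.* k} {nℕ} {x})))
    where
    fibre≐ : Fibre (diagonalForm a (3 ℕ.* a) (2 ℕ.* k) (2 ℕ.* k)) (+ nℕ) ≐ sumDiff ⊢ Sol
    fibre≐ =
      (λ {(x , y , z , w)} eq → trans (Q∘sumDiff≡diagonalForm x y z w) (trans eq nℕ≡n)) ,
      (λ {(x , y , z , w)} sol → trans (sym (Q∘sumDiff≡diagonalForm x y z w)) (trans sol (sym nℕ≡n)))

  E-size : ∀ {f} → Injective _≡_ _≡_ f → (∀ x → Q (f x) ≡ Q (evens x)) → (Sol ∩ Range f) HasSize E
  E-size {f} f-inj Q∘f≡Q∘evens =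
    size-image f-inj (size-resp fibre≐ (countQ-size (λ {x} → evensForm-bound {x})))
    where
    fibre≐ : Fibre evensForm (+ nℕ) ≐ f ⊢ Sol
    fibre≐ =
      (λ {x@(p , q , u , v)} eq → trans (Q∘f≡Q∘evens x)
         (trans (Q≡diagonalForm (+ 2 * p) (+ 2 * q) (toOdd u) (toOdd v)) (trans eq nℕ≡n))) ,
      (λ {x@(p , q , u , v)} sol → trans (sym (Q≡diagonalForm (+ 2 * p) (+ 2 * q) (toOdd u) (toOdd v)))
         (trans (sym (Q∘f≡Q∘evens x)) (trans sol (sym nℕ≡n))))

  N≡t+E : N a (3 ℕ.* a) (2 ℕ.* k) (2 ℕ.* k) nℕ ≡ t a (3 ℕ.* a) k k m ℕ.+ E
  N≡t+E = size-partition sumDiff-partition odds⊥evens N-size t-size (E-size evens-injective (λ _ → refl))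

  t≡E+E : t a (3 ℕ.* a) k k m ≡ E ℕ.+ E
  t≡E+E = size-partition odds-partition ψ₊⊥ψ₋ t-size
    (E-size ψ₊-injective Q∘ψ₊≡Q∘evens) (E-size ψ₋-injective Q∘ψ₋≡Q∘evens)

-- Opened only here: the modules above use the _+_ and _*_ of ℤ.
open import Data.Nat using (ℕ; _+_; _*_; _%_; NonZero)
open import Relation.Binary.PropositionalEquality using (_≡_)

theorem2p3 : (a k : ℕ) → NonZero a → NonZero k → (a * k) % 2 ≡ 1 →
    (m : ℕ) → NonZero m →
    3 * t a (3 * a) k k m ≡ 2 * N a (3 * a) (2 * k) (2 * k) (8 * m + 4 * a + 2 * k)
theorem2p3 a k a≢0 k≢0 ak-odd m _ = 3t≡2N N≡t+E t≡E+E
  where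
  ka-odd : (k * a) % 2 ≡ 1
  ka-odd = trans (cong (_% 2) (ℕP.*-comm k a)) ak-odd
  open Counts a k m {{a≢0}} {{k≢0}} (Parity.odd-product⇒odd a k ak-odd) (Parity.odd-product⇒odd k a ka-odd)
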